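{- Let $t,l:\mathbb N\to\mathbb N$ with $t(m)\ge1$, $t(m)=o(m)$, $l(m)=o(m)$, $\lim_{m\to\infty}(t(m)+l(m))=\infty$ and $\lim_{m\to\infty}\frac{t(m)}{\sqrt{l(m)}}=\infty$. Then \[ \lim_{m\to\infty}\frac{|\mathcal F_{l(m)}(2m,m,t(m))|}{\binom{2m}{m}}=0. \]
   Context: For integers $1\le t\le r\le n$ and $0\le i\le\frac{n-t}2$, $\mathcal F_i(n,r,t)=\{F\subseteq[n]:|F|=r,\ |F\cap[t+2i]|\ge t+i\}$, where $[p]=\{1,\dots,p\}$. -}

module Defs where

open import Data.Nat using (ℕ; zero; suc; _+_; _*_; _≤_; _<_; _≡ᵇ_; _≤ᵇ_; _<ᵇ_)
open import Data.Bool using (Bool; true; false; _∧_)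
open import Data.List using (List; []; _∷_; map; _++_; length; filter)
open import Data.Vec using (Vec; []; _∷_; tabulate)
open import Data.Fin using (Fin; toℕ)
open import Data.Fin.Subset using (Subset; ∣_∣; _∩_)
open import Relation.Nullary.Decidable using (Dec)
open import Data.Bool using (T)
open import Data.Bool.Properties using (T?)

allSubsets : (n : ℕ) → List (Subset n)
allSubsets zero = [] ∷ []
allSubsets (suc n) = map (true ∷_) (allSubsets n) ++ map (false ∷_) (allSubsets n)

-- The initial segment [p] = {1,…,p} ∩ [n]  (element j : Fin n stands for j+1).
initSeg : (n p : ℕ) → Subset n
initSeg n p = tabulate (λ j → toℕ j <ᵇ p)

inFam : (n r t i : ℕ) → Subset n → Bool
inFam n r t i F = (∣ F ∣ ≡ᵇ r) ∧ ((t + i) ≤ᵇ ∣ F ∩ initSeg n (t + (i + i)) ∣)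

famSize : (n r t i : ℕ) → ℕ
famSize n r t i = length (filter (λ F → T? (inFam n r t i F)) (allSubsets n))

module Submission where

-- Proof by the second moment method.  Fix m, put s = t + 2l and, for an m-subset F of
-- [2m], let X(F) = |F ∩ [s]|; X is hypergeometric with mean s/2.  Every F in
-- 𝓕_l(2m,m,t) has X ≥ t + l, hence |2X − s| ≥ t, so counting only the members gives
--     |𝓕_l(2m,m,t)| · t² ≤ Σ_{|F| = m} |2X − s|² ≤ s · C(2m,m).            (*)
-- The right-hand inequality is a variance bound: expanding |2X − s|², it follows from
-- the exact values of the factorial moments Σ 1, Σ X and Σ X(X−1) over the r-subsets
-- of [n], which are computed by induction on n through Pascal's rule.  Finally the
-- growth hypotheses give (k+1)·s ≤ t² for all large m, and (*) yields the theorem.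

open import Defs
open import Data.Nat.Combinatorics using (_C_; nC1≡n; nCk≡nC[n∸k]; nCk+nC[k+1]≡[n+1]C[k+1])
open import Data.Product using (∃-syntax; _×_; _,_)
open import Data.Nat
open import Data.Nat.Properties
open import Data.Nat.Solver using (module +-*-Solver)
open import Data.Bool using (Bool; true; false; T; if_then_else_)
open import Data.Bool.Properties using (T?)
open import Data.List using (List; []; _∷_; map; _++_; length; filter)
open import Data.Vec using (_∷_)
open import Data.Fin.Subset using (Subset; ∣_∣; _∩_)
open import Data.Sum using (inj₁; inj₂)
open import Data.Empty using (⊥-elim)
open import Relation.Nullary using (yes; no)
open import Relation.Binary.PropositionalEquality
open import Function using (_∘_; id)
open +-*-Solver

sumOver : {A : Set} → (A → ℕ) → List A → ℕ
sumOver g []       = 0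
sumOver g (x ∷ xs) = g x + sumOver g xs

sumOver-++ : {A : Set} (g : A → ℕ) (L M : List A) →
             sumOver g (L ++ M) ≡ sumOver g L + sumOver g M
sumOver-++ g []      M = refl
sumOver-++ g (x ∷ L) M = trans (cong (g x +_) (sumOver-++ g L M)) (sym (+-assoc (g x) _ _))

sumOver-map : {A B : Set} (g : B → ℕ) (h : A → B) (L : List A) →
              sumOver g (map h L) ≡ sumOver (g ∘ h) L
sumOver-map g h []      = refl
sumOver-map g h (x ∷ L) = cong (g (h x) +_) (sumOver-map g h L)

sumOver-cong : {A : Set} {g h : A → ℕ} → (∀ x → g x ≡ h x) → (L : List A) →
               sumOver g L ≡ sumOver h L
sumOver-cong e []      = refl
sumOver-cong e (x ∷ L) = cong₂ _+_ (e x) (sumOver-cong e L)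

sumOver-zero : {A : Set} (L : List A) → sumOver (λ _ → 0) L ≡ 0
sumOver-zero []      = refl
sumOver-zero (x ∷ L) = sumOver-zero L

sumOver-+ : {A : Set} (g h : A → ℕ) (L : List A) →
            sumOver (λ x → g x + h x) L ≡ sumOver g L + sumOver h L
sumOver-+ g h []      = refl
sumOver-+ g h (x ∷ L) rewrite sumOver-+ g h L =
  solve 4 (λ a b c d → a :+ b :+ (c :+ d) := a :+ c :+ (b :+ d)) refl
          (g x) (h x) (sumOver g L) (sumOver h L)

sumOver-* : {A : Set} (c : ℕ) (g : A → ℕ) (L : List A) →
            sumOver (λ x → c * g x) L ≡ c * sumOver g L
sumOver-* c g []      = sym (*-zeroʳ c)
sumOver-* c g (x ∷ L) rewrite sumOver-* c g L = sym (*-distribˡ-+ c (g x) _)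

count≤sum : {A : Set} (P : A → Bool) (g : A → ℕ) (c : ℕ) (L : List A) →
            (∀ x → T (P x) → c ≤ g x) → length (filter (T? ∘ P) L) * c ≤ sumOver g L
count≤sum P g c []      h = z≤n
count≤sum P g c (x ∷ L) h with P x in eq
... | true  = +-mono-≤ (h x (subst T (sym eq) _)) (count≤sum P g c L h)
... | false = ≤-trans (count≤sum P g c L h) (m≤n+m _ (g x))

atSize : {n : ℕ} → (p r : ℕ) → (ℕ → ℕ) → Subset n → ℕ
atSize {n} p r f F = if ∣ F ∣ ≡ᵇ r then f ∣ F ∩ initSeg n p ∣ else 0

windowSum : (n p r : ℕ) → (ℕ → ℕ) → ℕ
windowSum n p r f = sumOver (atSize p r f) (allSubsets n)

windowSum-split : ∀ n p r f →
  windowSum (suc n) p r f ≡ sumOver (atSize p r f ∘ (true ∷_)) (allSubsets n)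
                          + sumOver (atSize p r f ∘ (false ∷_)) (allSubsets n)
windowSum-split n p r f =
  trans (sumOver-++ (atSize p r f) (map (true ∷_) (allSubsets n)) _)
        (cong₂ _+_ (sumOver-map _ _ (allSubsets n)) (sumOver-map _ _ (allSubsets n)))

windowSum-inside : ∀ n p r f →
  windowSum (suc n) (suc p) (suc r) f ≡ windowSum n p r (f ∘ suc) + windowSum n p (suc r) f
windowSum-inside n p r = windowSum-split n (suc p) (suc r)

windowSum-outside : ∀ n r f →
  windowSum (suc n) 0 (suc r) f ≡ windowSum n 0 r f + windowSum n 0 (suc r) f
windowSum-outside n r = windowSum-split n 0 (suc r)

-- The only 0-subset is ∅, which meets the window in 0 elements.
windowSum-size0 : ∀ n p f → windowSum n p 0 f ≡ f 0
windowSum-size0 zero          p       f = +-identityʳ (f 0)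
windowSum-size0 (suc n)       zero    f =
  trans (windowSum-split n 0 0 f) (cong₂ _+_ (sumOver-zero (allSubsets n)) (windowSum-size0 n 0 f))
windowSum-size0 (suc n)       (suc p) f =
  trans (windowSum-split n (suc p) 0 f) (cong₂ _+_ (sumOver-zero (allSubsets n)) (windowSum-size0 n p f))

windowSum-cong : ∀ n p r {f g} → (∀ x → f x ≡ g x) → windowSum n p r f ≡ windowSum n p r g
windowSum-cong n p r {f} {g} e = sumOver-cong pointwise (allSubsets n)
  where
  pointwise : (F : Subset n) → atSize p r f F ≡ atSize p r g F
  pointwise F with ∣ F ∣ ≡ᵇ r
  ... | true  = e _
  ... | false = refl

windowSum-+ : ∀ n p r f g →
  windowSum n p r (λ x → f x + g x) ≡ windowSum n p r f + windowSum n p r g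
windowSum-+ n p r f g = trans (sumOver-cong pointwise (allSubsets n)) (sumOver-+ _ _ (allSubsets n))
  where
  pointwise : (F : Subset n) → atSize p r (λ x → f x + g x) F ≡ atSize p r f F + atSize p r g F
  pointwise F with ∣ F ∣ ≡ᵇ r
  ... | true  = refl
  ... | false = refl

windowSum-* : ∀ n p r c f → windowSum n p r (λ x → c * f x) ≡ c * windowSum n p r f
windowSum-* n p r c f = trans (sumOver-cong pointwise (allSubsets n)) (sumOver-* c _ (allSubsets n))
  where
  pointwise : (F : Subset n) → atSize p r (λ x → c * f x) F ≡ c * atSize p r f F
  pointwise F with ∣ F ∣ ≡ᵇ r
  ... | true  = refl
  ... | false = sym (*-zeroʳ c)

fall2 : ℕ → ℕ
fall2 x = x * pred x

fall2-suc : ∀ x → fall2 (suc x) ≡ fall2 x + 2 * x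
fall2-suc zero    = refl
fall2-suc (suc x) = solve 1 (λ x → (con 2 :+ x) :* (con 1 :+ x) := (con 1 :+ x) :* x :+ con 2 :* (con 1 :+ x)) refl x

fall2+id : ∀ x → fall2 x + x ≡ x * x
fall2+id zero    = refl
fall2+id (suc x) = solve 1 (λ x → (con 1 :+ x) :* x :+ (con 1 :+ x) := (con 1 :+ x) :* (con 1 :+ x)) refl x

windowSum-suc : ∀ n p r → windowSum n p r suc ≡ windowSum n p r id + windowSum n p r (λ _ → 1)
windowSum-suc n p r = trans (windowSum-cong n p r (λ x → +-comm 1 x)) (windowSum-+ n p r id (λ _ → 1))

windowSum-fall2-suc : ∀ n p r →
  windowSum n p r (fall2 ∘ suc) ≡ windowSum n p r fall2 + 2 * windowSum n p r id
windowSum-fall2-suc n p r =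
  trans (windowSum-cong n p r fall2-suc)
        (trans (windowSum-+ n p r fall2 (λ x → 2 * x)) (cong (windowSum n p r fall2 +_) (windowSum-* n p r 2 id)))

subsetCount : ∀ n p r → windowSum n p r (λ _ → 1) ≡ n C r
subsetCount zero    p       zero    = refl
subsetCount zero    p       (suc r) = refl
subsetCount (suc n) p       zero    = windowSum-size0 (suc n) p (λ _ → 1)
subsetCount (suc n) zero    (suc r) =
  trans (windowSum-outside n r _)
        (trans (cong₂ _+_ (subsetCount n 0 r) (subsetCount n 0 (suc r))) (nCk+nC[k+1]≡[n+1]C[k+1] n r))
subsetCount (suc n) (suc p) (suc r) =
  trans (windowSum-inside n p r _)
        (trans (cong₂ _+_ (subsetCount n p r) (subsetCount n p (suc r))) (nCk+nC[k+1]≡[n+1]C[k+1] n r))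

-- With an empty window every subset meets it in 0 elements.
windowSum-emptyWindow : ∀ n r f → windowSum n 0 r f ≡ f 0 * (n C r)
windowSum-emptyWindow n       zero    f = trans (windowSum-size0 n 0 f) (sym (*-identityʳ (f 0)))
windowSum-emptyWindow zero    (suc r) f = sym (*-zeroʳ (f 0))
windowSum-emptyWindow (suc n) (suc r) f = begin
    windowSum (suc n) 0 (suc r) f
  ≡⟨ windowSum-outside n r f ⟩
    windowSum n 0 r f + windowSum n 0 (suc r) f
  ≡⟨ cong₂ _+_ (windowSum-emptyWindow n r f) (windowSum-emptyWindow n (suc r) f) ⟩
    f 0 * (n C r) + f 0 * (n C suc r)
  ≡⟨ sym (*-distribˡ-+ (f 0) _ _) ⟩
    f 0 * (n C r + n C suc r)
  ≡⟨ cong (f 0 *_) (nCk+nC[k+1]≡[n+1]C[k+1] n r) ⟩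
    f 0 * (suc n C suc r)
  ∎
  where open ≡-Reasoning

firstMoment : ∀ n p r → p ≤ suc n → windowSum (suc n) p (suc r) id ≡ p * (n C r)
firstMoment n       zero          r       _         = windowSum-emptyWindow (suc n) (suc r) id
firstMoment zero    (suc zero)    zero    _         = refl
firstMoment zero    (suc zero)    (suc r) _         = refl
firstMoment zero    (suc (suc p)) r       (s≤s ())
firstMoment (suc n) (suc p)       zero    (s≤s p≤n) =
  trans (windowSum-inside (suc n) p 0 id) (cong₂ _+_ (windowSum-size0 (suc n) p suc) (firstMoment n p 0 p≤n))
firstMoment (suc n) (suc p)       (suc r) (s≤s p≤n) = begin
    windowSum (suc (suc n)) (suc p) (suc (suc r)) id
  ≡⟨ windowSum-inside (suc n) p (suc r) id ⟩
    windowSum (suc n) p (suc r) suc + windowSum (suc n) p (suc (suc r)) id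
  ≡⟨ cong (_+ windowSum (suc n) p (suc (suc r)) id) (windowSum-suc (suc n) p (suc r)) ⟩
    windowSum (suc n) p (suc r) id + windowSum (suc n) p (suc r) (λ _ → 1) + windowSum (suc n) p (suc (suc r)) id
  ≡⟨ cong₂ _+_ (cong₂ _+_ (firstMoment n p r p≤n) (subsetCount (suc n) p (suc r))) (firstMoment n p (suc r) p≤n) ⟩
    p * (n C r) + suc n C suc r + p * (n C suc r)
  ≡⟨ cong (λ z → p * (n C r) + z + p * (n C suc r)) (sym (nCk+nC[k+1]≡[n+1]C[k+1] n r)) ⟩
    p * (n C r) + (n C r + n C suc r) + p * (n C suc r)
  ≡⟨ solve 3 (λ p a b → p :* a :+ (a :+ b) :+ p :* b := (con 1 :+ p) :* (a :+ b)) refl p (n C r) (n C suc r) ⟩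
    suc p * (n C r + n C suc r)
  ≡⟨ cong (suc p *_) (nCk+nC[k+1]≡[n+1]C[k+1] n r) ⟩
    suc p * (suc n C suc r)
  ∎
  where open ≡-Reasoning

-- A singleton meets the window in at most one element, so X(X−1) vanishes on it.
windowSum-fall2-singletons : ∀ n p → windowSum n p 1 fall2 ≡ 0
windowSum-fall2-singletons zero    p       = refl
windowSum-fall2-singletons (suc n) zero    = windowSum-emptyWindow (suc n) 1 fall2
windowSum-fall2-singletons (suc n) (suc p) =
  trans (windowSum-inside n p 0 fall2)
        (cong₂ _+_ (windowSum-size0 n p (fall2 ∘ suc)) (windowSum-fall2-singletons n p))

secondMoment : ∀ n p r → p ≤ suc (suc n) →
               windowSum (suc (suc n)) p (suc (suc r)) fall2 ≡ fall2 p * (n C r)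
secondMoment n       zero                r       _         = windowSum-emptyWindow (suc (suc n)) (suc (suc r)) fall2
secondMoment zero    (suc zero)          zero    _         = refl
secondMoment zero    (suc zero)          (suc r) _         = refl
secondMoment zero    (suc (suc zero))    zero    _         = refl
secondMoment zero    (suc (suc zero))    (suc r) _         = refl
secondMoment zero    (suc (suc (suc p))) r       (s≤s (s≤s ()))
secondMoment (suc n) (suc p)             zero    (s≤s p≤n) = begin
    windowSum (suc (suc (suc n))) (suc p) 2 fall2
  ≡⟨ windowSum-inside (suc (suc n)) p 1 fall2 ⟩
    windowSum (suc (suc n)) p 1 (fall2 ∘ suc) + windowSum (suc (suc n)) p 2 fall2
  ≡⟨ cong (_+ windowSum (suc (suc n)) p 2 fall2) (windowSum-fall2-suc (suc (suc n)) p 1) ⟩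
    windowSum (suc (suc n)) p 1 fall2 + 2 * windowSum (suc (suc n)) p 1 id + windowSum (suc (suc n)) p 2 fall2
  ≡⟨ cong₂ _+_ (cong₂ _+_ (windowSum-fall2-singletons (suc (suc n)) p) (cong (2 *_) (firstMoment (suc n) p 0 p≤n)))
               (secondMoment n p 0 p≤n) ⟩
    2 * (p * 1) + fall2 p * 1
  ≡⟨ solve 2 (λ p x → con 2 :* (p :* con 1) :+ x :* con 1 := (x :+ con 2 :* p) :* con 1) refl p (fall2 p) ⟩
    (fall2 p + 2 * p) * 1
  ≡⟨ cong (_* 1) (sym (fall2-suc p)) ⟩
    fall2 (suc p) * 1
  ∎
  where open ≡-Reasoning
secondMoment (suc n) (suc p)             (suc r) (s≤s p≤n) = begin
    windowSum (suc (suc (suc n))) (suc p) (suc (suc (suc r))) fall2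
  ≡⟨ windowSum-inside (suc (suc n)) p (suc (suc r)) fall2 ⟩
    windowSum (suc (suc n)) p (suc (suc r)) (fall2 ∘ suc) + windowSum (suc (suc n)) p (suc (suc (suc r))) fall2
  ≡⟨ cong (_+ windowSum (suc (suc n)) p (suc (suc (suc r))) fall2) (windowSum-fall2-suc (suc (suc n)) p (suc (suc r))) ⟩
    windowSum (suc (suc n)) p (suc (suc r)) fall2 + 2 * windowSum (suc (suc n)) p (suc (suc r)) id
      + windowSum (suc (suc n)) p (suc (suc (suc r))) fall2
  ≡⟨ cong₂ _+_ (cong₂ _+_ (secondMoment n p r p≤n) (cong (2 *_) (firstMoment (suc n) p (suc r) p≤n)))
               (secondMoment n p (suc r) p≤n) ⟩
    fall2 p * (n C r) + 2 * (p * (suc n C suc r)) + fall2 p * (n C suc r)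
  ≡⟨ cong (λ z → fall2 p * (n C r) + 2 * (p * z) + fall2 p * (n C suc r)) (sym (nCk+nC[k+1]≡[n+1]C[k+1] n r)) ⟩
    fall2 p * (n C r) + 2 * (p * (n C r + n C suc r)) + fall2 p * (n C suc r)
  ≡⟨ solve 4 (λ p x a b → x :* a :+ con 2 :* (p :* (a :+ b)) :+ x :* b := (x :+ con 2 :* p) :* (a :+ b))
             refl p (fall2 p) (n C r) (n C suc r) ⟩
    (fall2 p + 2 * p) * (n C r + n C suc r)
  ≡⟨ cong₂ _*_ (sym (fall2-suc p)) (nCk+nC[k+1]≡[n+1]C[k+1] n r) ⟩
    fall2 (suc p) * (suc n C suc r)
  ∎
  where open ≡-Reasoning

windowSum-quadratic : ∀ n p r a b c →
  windowSum n p r (λ x → a * fall2 x + b * x + c)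
    ≡ a * windowSum n p r fall2 + b * windowSum n p r id + c * windowSum n p r (λ _ → 1)
windowSum-quadratic n p r a b c = begin
    windowSum n p r (λ x → a * fall2 x + b * x + c)
  ≡⟨ windowSum-cong n p r (λ x → cong (a * fall2 x + b * x +_) (sym (*-identityʳ c))) ⟩
    windowSum n p r (λ x → a * fall2 x + b * x + c * 1)
  ≡⟨ windowSum-+ n p r (λ x → a * fall2 x + b * x) (λ _ → c * 1) ⟩
    windowSum n p r (λ x → a * fall2 x + b * x) + windowSum n p r (λ _ → c * 1)
  ≡⟨ cong₂ _+_ (windowSum-+ n p r (λ x → a * fall2 x) (λ x → b * x)) (windowSum-* n p r c (λ _ → 1)) ⟩
    windowSum n p r (λ x → a * fall2 x) + windowSum n p r (λ x → b * x) + c * windowSum n p r (λ _ → 1)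
  ≡⟨ cong (_+ c * windowSum n p r (λ _ → 1)) (cong₂ _+_ (windowSum-* n p r a fall2) (windowSum-* n p r b id)) ⟩
    a * windowSum n p r fall2 + b * windowSum n p r id + c * windowSum n p r (λ _ → 1)
  ∎
  where open ≡-Reasoning

absorption : ∀ n k → suc k * (suc n C suc k) ≡ suc n * (n C k)
absorption zero    zero    = refl
absorption zero    (suc k) = *-zeroʳ (suc (suc k))
absorption (suc n) zero    =
  trans (+-identityʳ (suc (suc n) C 1)) (trans (nC1≡n (suc (suc n))) (sym (*-identityʳ (suc (suc n)))))
absorption (suc n) (suc k) = begin
    suc (suc k) * (suc (suc n) C suc (suc k))
  ≡⟨ cong (suc (suc k) *_) (sym (nCk+nC[k+1]≡[n+1]C[k+1] (suc n) (suc k))) ⟩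
    suc (suc k) * (a + b)
  ≡⟨ solve 3 (λ k a b → (con 2 :+ k) :* (a :+ b) := a :+ ((con 1 :+ k) :* a :+ (con 2 :+ k) :* b)) refl k a b ⟩
    a + (suc k * a + suc (suc k) * b)
  ≡⟨ cong (a +_) (cong₂ _+_ (absorption n k) (absorption n (suc k))) ⟩
    a + (suc n * (n C k) + suc n * (n C suc k))
  ≡⟨ cong (a +_) (sym (*-distribˡ-+ (suc n) (n C k) (n C suc k))) ⟩
    a + suc n * (n C k + n C suc k)
  ≡⟨ cong (λ z → a + suc n * z) (nCk+nC[k+1]≡[n+1]C[k+1] n k) ⟩
    suc (suc n) * a
  ∎
  where
  open ≡-Reasoning
  a = suc n C suc k
  b = suc n C suc (suc k)

centralBinomial : ∀ q → (suc q + suc q) C suc q ≡ 2 * ((q + suc q) C q)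
centralBinomial q = begin
    suc n C suc q
  ≡⟨ sym (nCk+nC[k+1]≡[n+1]C[k+1] n q) ⟩
    n C q + n C suc q
  ≡⟨ cong (n C q +_) (trans (nCk≡nC[n∸k] (m≤n+m (suc q) q)) (cong (n C_) (m+n∸n≡m q (suc q)))) ⟩
    n C q + n C q
  ≡⟨ cong (n C q +_) (sym (+-identityʳ (n C q))) ⟩
    2 * (n C q)
  ∎
  where
  open ≡-Reasoning
  n = q + suc q

sqDist-≤ : ∀ {a b} → a ≤ b → ∣ a - b ∣ * ∣ a - b ∣ + 2 * a * b ≡ a * a + b * b
sqDist-≤ {a} {b} a≤b = begin
    ∣ a - b ∣ * ∣ a - b ∣ + 2 * a * b
  ≡⟨ cong (λ z → z * z + 2 * a * b) (m≤n⇒∣m-n∣≡n∸m a≤b) ⟩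
    d * d + 2 * a * b
  ≡⟨ cong (λ z → d * d + 2 * a * z) (sym b≡a+d) ⟩
    d * d + 2 * a * (a + d)
  ≡⟨ solve 2 (λ a d → d :* d :+ con 2 :* a :* (a :+ d) := a :* a :+ (a :+ d) :* (a :+ d)) refl a d ⟩
    a * a + (a + d) * (a + d)
  ≡⟨ cong (λ z → a * a + z * z) b≡a+d ⟩
    a * a + b * b
  ∎
  where
  open ≡-Reasoning
  d = b ∸ a
  b≡a+d : a + d ≡ b
  b≡a+d = m+[n∸m]≡n a≤b

sqDist : ∀ a b → ∣ a - b ∣ * ∣ a - b ∣ + 2 * a * b ≡ a * a + b * b
sqDist a b with ≤-total a b
... | inj₁ a≤b = sqDist-≤ a≤b
... | inj₂ b≤a = begin
    ∣ a - b ∣ * ∣ a - b ∣ + 2 * a * b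
  ≡⟨ cong₂ (λ d e → d * d + e) (∣-∣-comm a b) (solve 2 (λ a b → con 2 :* a :* b := con 2 :* b :* a) refl a b) ⟩
    ∣ b - a ∣ * ∣ b - a ∣ + 2 * b * a
  ≡⟨ sqDist-≤ b≤a ⟩
    b * b + a * a
  ≡⟨ +-comm (b * b) (a * a) ⟩
    a * a + b * b
  ∎
  where open ≡-Reasoning

dev : ℕ → ℕ → ℕ
dev s x = ∣ x + x - s ∣ * ∣ x + x - s ∣

-- Its expansion in the falling basis (the ℕ form of (2x − s)² = 4x(x−1) + 4x − 4sx + s²).
dev-expand : ∀ s x → dev s x + 4 * s * x ≡ 4 * fall2 x + 4 * x + s * s
dev-expand s x = begin
    dev s x + 4 * s * x
  ≡⟨ cong (dev s x +_) (solve 2 (λ s x → con 4 :* s :* x := con 2 :* (x :+ x) :* s) refl s x) ⟩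
    dev s x + 2 * (x + x) * s
  ≡⟨ sqDist (x + x) s ⟩
    (x + x) * (x + x) + s * s
  ≡⟨ cong (_+ s * s) (solve 1 (λ x → (x :+ x) :* (x :+ x) := con 4 :* (x :* x)) refl x) ⟩
    4 * (x * x) + s * s
  ≡⟨ cong (λ z → 4 * z + s * s) (sym (fall2+id x)) ⟩
    4 * (fall2 x + x) + s * s
  ≡⟨ cong (_+ s * s) (*-distribˡ-+ 4 (fall2 x) x) ⟩
    4 * fall2 x + 4 * x + s * s
  ∎
  where open ≡-Reasoning

-- With m = q+2, B₁ = C(2m−1, m−1),
-- B₂ = C(2m−2, m−2) and K+1 = 2m−1 ≥ 2(m−1), the moment identity for A = Σ|2X − s|² together with
-- K·B₂ = (m−1)·B₁ gives A ≤ 2s·B₁ = s·C(2m, m).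
varianceArith : ∀ A s q K B₁ B₂ → 2 * suc q ≤ suc K → suc K * B₂ ≡ suc q * B₁ →
  A + 4 * s * (s * B₁) ≡ 4 * (fall2 s * B₂) + 4 * (s * B₁) + s * s * (2 * B₁) →
  A ≤ s * (2 * B₁)
varianceArith A s q K B₁ B₂ 2q+2≤K absorb moments =
  +-cancelʳ-≤ (4 * s * (s * B₁)) A (s * (2 * B₁)) (*-cancelˡ-≤ (suc K) (begin
    suc K * (A + 4 * s * (s * B₁))
  ≡⟨ cong (suc K *_) moments ⟩
    suc K * (4 * (f * B₂) + 4 * (s * B₁) + s * s * (2 * B₁))
  ≡⟨ solve 5 (λ k f b₂ s b₁ → k :* (con 4 :* (f :* b₂) :+ con 4 :* (s :* b₁) :+ s :* s :* (con 2 :* b₁))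
                              := con 4 :* f :* (k :* b₂) :+ k :* (con 4 :* (s :* b₁) :+ s :* s :* (con 2 :* b₁)))
             refl (suc K) f B₂ s B₁ ⟩
    4 * f * (suc K * B₂) + suc K * rest
  ≡⟨ cong (λ z → 4 * f * z + suc K * rest) absorb ⟩
    4 * f * (suc q * B₁) + suc K * rest
  ≡⟨ cong (_+ suc K * rest) (solve 3 (λ f q b → con 4 :* f :* (q :* b) := (con 2 :* q) :* (con 2 :* (f :* b)))
                                     refl f (suc q) B₁) ⟩
    2 * suc q * (2 * (f * B₁)) + suc K * rest
  ≤⟨ +-monoˡ-≤ (suc K * rest) (*-monoˡ-≤ (2 * (f * B₁)) 2q+2≤K) ⟩
    suc K * (2 * (f * B₁)) + suc K * rest
  ≡⟨ solve 4 (λ k f s b → k :* (con 2 :* (f :* b)) :+ k :* (con 4 :* (s :* b) :+ s :* s :* (con 2 :* b))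
                          := k :* (con 2 :* ((f :+ s) :* b) :+ con 2 :* (s :* b) :+ s :* s :* (con 2 :* b)))
             refl (suc K) f s B₁ ⟩
    suc K * (2 * ((f + s) * B₁) + 2 * (s * B₁) + s * s * (2 * B₁))
  ≡⟨ cong (λ z → suc K * (2 * (z * B₁) + 2 * (s * B₁) + s * s * (2 * B₁))) (fall2+id s) ⟩
    suc K * (2 * (s * s * B₁) + 2 * (s * B₁) + s * s * (2 * B₁))
  ≡⟨ cong (suc K *_) (solve 2 (λ s b → con 2 :* (s :* s :* b) :+ con 2 :* (s :* b) :+ s :* s :* (con 2 :* b)
                                       := s :* (con 2 :* b) :+ con 4 :* s :* (s :* b)) refl s B₁) ⟩
    suc K * (s * (2 * B₁) + 4 * s * (s * B₁))
  ∎))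
  where
  open ≤-Reasoning
  f    = fall2 s
  rest = 4 * (s * B₁) + s * s * (2 * B₁)

varianceBound : ∀ {m s} → 2 ≤ m → s ≤ m + m → windowSum (m + m) s m (dev s) ≤ s * ((m + m) C m)
varianceBound {suc (suc q)} {s} (s≤s (s≤s _)) s≤2m =
  subst (λ c → A ≤ s * c) (sym (centralBinomial (suc q))) (varianceArith A s q K B₁ B₂ 2q+2≤K absorb moments)
  where
  open ≡-Reasoning
  K  = q + suc (suc q)
  n  = suc (suc K)
  m  = suc (suc q)
  A  = windowSum n s m (dev s)
  B₁ = suc K C suc q
  B₂ = K C q
  2q+2≤K : 2 * suc q ≤ suc K
  2q+2≤K = ≤-trans (n≤1+n _) (≤-reflexive
    (solve 1 (λ q → con 1 :+ con 2 :* (con 1 :+ q) := con 1 :+ (q :+ (con 2 :+ q))) refl q))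
  absorb : suc K * B₂ ≡ suc q * B₁
  absorb = sym (absorption K q)
  moments : A + 4 * s * (s * B₁) ≡ 4 * (fall2 s * B₂) + 4 * (s * B₁) + s * s * (2 * B₁)
  moments = begin
      A + 4 * s * (s * B₁)
    ≡⟨ cong (λ z → A + 4 * s * z) (sym (firstMoment (suc K) s (suc q) s≤2m)) ⟩
      A + 4 * s * windowSum n s m id
    ≡⟨ cong (A +_) (sym (windowSum-* n s m (4 * s) id)) ⟩
      A + windowSum n s m (λ x → 4 * s * x)
    ≡⟨ sym (windowSum-+ n s m (dev s) (λ x → 4 * s * x)) ⟩
      windowSum n s m (λ x → dev s x + 4 * s * x)
    ≡⟨ windowSum-cong n s m (dev-expand s) ⟩
      windowSum n s m (λ x → 4 * fall2 x + 4 * x + s * s)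
    ≡⟨ windowSum-quadratic n s m 4 4 (s * s) ⟩
      4 * windowSum n s m fall2 + 4 * windowSum n s m id + s * s * windowSum n s m (λ _ → 1)
    ≡⟨ cong₂ _+_ (cong₂ _+_ (cong (4 *_) (secondMoment K s q s≤2m)) (cong (4 *_) (firstMoment (suc K) s (suc q) s≤2m)))
                 (cong (s * s *_) (trans (subsetCount n s m) (centralBinomial (suc q)))) ⟩
      4 * (fall2 s * B₂) + 4 * (s * B₁) + s * s * (2 * B₁)
    ∎

deviation≥t : ∀ t l X → t + l ≤ X → t ≤ ∣ X + X - (t + (l + l)) ∣
deviation≥t t l X t+l≤X = begin
    t
  ≡⟨ sym 2[t+l]∸s≡t ⟩
    (t + l) + (t + l) ∸ s
  ≤⟨ ∸-monoˡ-≤ s (+-mono-≤ t+l≤X t+l≤X) ⟩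
    X + X ∸ s
  ≤⟨ m∸n≤∣m-n∣ (X + X) s ⟩
    ∣ X + X - s ∣
  ∎
  where
  open ≤-Reasoning
  s = t + (l + l)
  2[t+l]∸s≡t : (t + l) + (t + l) ∸ s ≡ t
  2[t+l]∸s≡t = trans (cong (_∸ s) (solve 2 (λ t l → (t :+ l) :+ (t :+ l) := (t :+ (l :+ l)) :+ t) refl t l))
                     (m+n∸m≡n s t)

famSize-bound : ∀ n m t l → famSize n m t l * (t * t) ≤ windowSum n (t + (l + l)) m (dev (t + (l + l)))
famSize-bound n m t l = count≤sum (inFam n m t l) _ (t * t) (allSubsets n) member
  where
  member : (F : Subset n) → T (inFam n m t l F) → t * t ≤ atSize (t + (l + l)) m (dev (t + (l + l))) F
  member F inF with ∣ F ∣ ≡ᵇ m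
  ... | true  = let t≤dev = deviation≥t t l _ (≤ᵇ⇒≤ (t + l) _ inF) in *-mono-≤ t≤dev t≤dev
  ... | false = ⊥-elim inF

-- If t + l ≥ K and K²·l < t², then already t ≥ K (if l ≥ 1 then K² ≤ K²·l < t²).
large-t : ∀ {K t l} → K ≤ t + l → K * K * l < t * t → K ≤ t
large-t {K} {t} {zero}  K≤t+l _     = subst (K ≤_) (+-identityʳ t) K≤t+l
large-t {K} {t} {suc l} _     K²l<t² with K ≤? t
... | yes K≤t = K≤t
... | no  K≰t = ⊥-elim (<⇒≱ (≤-<-trans (m≤m*n (K * K) (suc l)) K²l<t²) (*-mono-≤ t≤K t≤K))
  where t≤K = <⇒≤ (≰⇒> K≰t)

budget : ∀ k {t l} → 2 * suc k ≤ t → 2 * suc k * (2 * suc k) * l < t * t → suc k * (t + (l + l)) ≤ t * t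
budget k {t} {l} K≤t K²l<t² = *-cancelˡ-≤ 2 (begin
    2 * (suc k * (t + (l + l)))
  ≡⟨ solve 3 (λ k t l → con 2 :* (k :* (t :+ (l :+ l))) := con 2 :* k :* t :+ con 4 :* k :* l) refl (suc k) t l ⟩
    2 * suc k * t + 4 * suc k * l
  ≤⟨ +-mono-≤ (*-monoˡ-≤ t K≤t) (*-monoˡ-≤ l 4k≤K²) ⟩
    t * t + K * K * l
  ≤⟨ +-monoʳ-≤ (t * t) (<⇒≤ K²l<t²) ⟩
    t * t + t * t
  ≡⟨ cong (t * t +_) (sym (+-identityʳ (t * t))) ⟩
    2 * (t * t)
  ∎)
  where
  open ≤-Reasoning
  K = 2 * suc k
  4k≤K² : 4 * suc k ≤ K * K
  4k≤K² = ≤-trans (m≤m*n (4 * suc k) (suc k))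
                  (≤-reflexive (solve 1 (λ k → con 4 :* k :* k := con 2 :* k :* (con 2 :* k)) refl (suc k)))

centralBound : ∀ k {m t l} → 1 ≤ t → 2 * t ≤ m → 2 * l ≤ m → 2 * suc k ≤ t →
               2 * suc k * (2 * suc k) * l < t * t → suc k * famSize (m + m) m t l ≤ (m + m) C m
centralBound k {m} {t} {l} 1≤t 2t≤m 2l≤m K≤t K²l<t² =
  *-cancelʳ-≤ (suc k * F) Cm (t * t) {{>-nonZero (*-mono-≤ 1≤t 1≤t)}} (begin
    suc k * F * (t * t)
  ≡⟨ *-assoc (suc k) F (t * t) ⟩
    suc k * (F * (t * t))
  ≤⟨ *-monoʳ-≤ (suc k) (≤-trans (famSize-bound (m + m) m t l) (varianceBound 2≤m s≤2m)) ⟩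
    suc k * (s * Cm)
  ≡⟨ sym (*-assoc (suc k) s Cm) ⟩
    suc k * s * Cm
  ≤⟨ *-monoˡ-≤ Cm (budget k K≤t K²l<t²) ⟩
    t * t * Cm
  ≡⟨ *-comm (t * t) Cm ⟩
    Cm * (t * t)
  ∎)
  where
  open ≤-Reasoning
  s  = t + (l + l)
  F  = famSize (m + m) m t l
  Cm = (m + m) C m
  2≤m : 2 ≤ m
  2≤m = ≤-trans (*-monoʳ-≤ 2 1≤t) 2t≤m
  s≤2m : s ≤ m + m
  s≤2m = +-mono-≤ (≤-trans (m≤m+n t _) 2t≤m) (subst (_≤ m) (cong (l +_) (+-identityʳ l)) 2l≤m)

Eventually : (ℕ → Set) → Set
Eventually P = ∃[ N ] ∀ m → N ≤ m → P m

eventually-both : ∀ {P Q : ℕ → Set} → Eventually P → Eventually Q → Eventually (λ m → P m × Q m)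
eventually-both (M , p) (N , q) =
  M ⊔ N , λ m M⊔N≤m → p m (≤-trans (m≤m⊔n M N) M⊔N≤m) , q m (≤-trans (m≤n⊔m M N) M⊔N≤m)

eventually-mono : ∀ {P Q : ℕ → Set} → (∀ m → P m → Q m) → Eventually P → Eventually Q
eventually-mono P⇒Q (N , p) = N , λ m N≤m → P⇒Q m (p m N≤m)

-- Take K = 2(k+1); eventually 2t ≤ m,
-- 2l ≤ m, K ≤ t + l and K²·l < t², and then centralBound applies.
lemma2p8 : (t l : ℕ → ℕ) →
    (∀ m → 1 ≤ t m) →
    (∀ k → ∃[ N ] ∀ m → N ≤ m → suc k * t m ≤ m) →
    (∀ k → ∃[ N ] ∀ m → N ≤ m → suc k * l m ≤ m) →
    (∀ K → ∃[ N ] ∀ m → N ≤ m → K ≤ t m + l m) →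
    (∀ K → ∃[ N ] ∀ m → N ≤ m → K * K * l m < t m * t m) →
    ∀ k → ∃[ N ] ∀ m → N ≤ m →
    suc k * famSize (m + m) m (t m) (l m) ≤ (m + m) C m
lemma2p8 t l t≥1 t-sublinear l-sublinear t+l-unbounded t²/l-unbounded k =
  eventually-mono bound
    (eventually-both (t-sublinear 1)
      (eventually-both (l-sublinear 1)
        (eventually-both (t+l-unbounded K) (t²/l-unbounded K))))
  where
  K = 2 * suc k
  bound : ∀ m → 2 * t m ≤ m × 2 * l m ≤ m × K ≤ t m + l m × K * K * l m < t m * t m →
          suc k * famSize (m + m) m (t m) (l m) ≤ (m + m) C m
  bound m (2t≤m , 2l≤m , K≤t+l , K²l<t²) =
    centralBound k (t≥1 m) 2t≤m 2l≤m (large-t K≤t+l K²l<t²) K²l<t²
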